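{- A uniform association scheme is dismantlable. Any dismantled scheme of a uniform scheme is also uniform.
   Context: A symmetric $d$-class association scheme $(X,\mathcal R)$: partition $\{R_0,\dots,R_d\}$ of $X\times X$, $R_0$ diagonal, each $R_i$ symmetric, constant intersection numbers; $A_i$ adjacency matrices. An imprimitivity system: an index set $\mathcal I$ with $\{0\}\subsetneq\mathcal I\subsetneq\{0,\dots,d\}$ such that $\bigcup_{i\in\mathcal I}R_i$ is an equivalence relation whose classes (fibres) all have size $n$; $w$ fibres. For fibres $U,V$ let $\mathcal I(U,V)=\{i:R_i\cap(U\times V)\ne\emptyset\}$ and let $M^{UV}$ agree with $M$ on $U\times V$ and be zero elsewhere. Uniform: $\mathcal I(U,V)=\{0,\dots,d\}\setminus\mathcal I$ for all distinct fibres $U,V$, and there are integers $a^h_{ij}$ with $A_i^{UV}A_j^{VW}=\sum_ha^h_{ij}A_h^{UW}$ for all fibres $U,V,W$, $i\in\mathcal I(U,V)$, $j\in\mathcal I(V,W)$. Dismantlable: for every union $Y$ of fibres, the nonempty relations among $R_i\cap(Y\times Y)$ form an association scheme on $Y$; when $Y$ is a union of at least two fibres this is a dismantled scheme (with the induced imprimitivity system on $Y$). -}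

module Defs where

open import Data.Nat using (ℕ; zero; suc)
open import Data.Fin using (Fin; zero; suc; _≟_)
open import Data.Bool using (Bool; true; false; _∧_; if_then_else_)
open import Data.Integer using (ℤ; 0ℤ; 1ℤ; _+_; _*_)
open import Data.Product using (Σ; ∃; _×_; _,_)
open import Relation.Nullary using (¬_)
open import Relation.Nullary.Decidable using (⌊_⌋)
open import Relation.Binary.PropositionalEquality using (_≡_)
open import Function.Bundles using (_⇔_)

count : {n : ℕ} → (Fin n → Bool) → ℕ
count {zero}  p = 0
count {suc n} p = (if p zero then 1 else 0) Data.Nat.+ count (λ k → p (suc k))

sumF : {n : ℕ} → (Fin n → ℤ) → ℤ
sumF {zero}  f = 0ℤ
sumF {suc n} f = f zero + sumF (λ k → f (suc k))

Mat : ℕ → Set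
Mat N = Fin N → Fin N → ℤ

_⊗_ : {N : ℕ} → Mat N → Mat N → Mat N
(A ⊗ B) x z = sumF (λ y → A x y * B y z)

ind : Bool → ℤ
ind b = if b then 1ℤ else 0ℤ

_==_ : {m : ℕ} → Fin m → Fin m → Bool
a == b = ⌊ a ≟ b ⌋

-- Setting: point set X = Fin N, relations R_0..R_d given by a labelling
--   r : Fin N → Fin N → Fin (suc d),   (x , y) ∈ R_i  iff  r x y ≡ i.
-- Everything is stated relative to a subset Y ⊆ X (a Bool predicate);
-- Y = everything gives the original scheme, and a union of fibres Y
-- gives the (candidate) dismantled scheme, whose relations are the
-- nonempty ones among R_i ∩ (Y × Y).

module _ {N d : ℕ} (r : Fin N → Fin N → Fin (suc d)) (Y : Fin N → Bool) where

  In : Fin N → Set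
  In x = Y x ≡ true

  Occurs : Fin (suc d) → Set
  Occurs i = ∃ λ x → ∃ λ y → In x × In y × r x y ≡ i

  -- The nonempty relations among R_i ∩ (Y×Y) form an association scheme on Y
  record IsSchemeOn : Set where
    field
      diagonal  : ∀ x y → In x → In y → (r x y ≡ zero ⇔ x ≡ y)
      symmetric : ∀ x y → In x → In y → r x y ≡ r y x
      intersect : ∀ (i j h : Fin (suc d)) → ∃ λ (p : ℕ) →
                    ∀ x y → In x → In y → r x y ≡ h →
                    count (λ z → Y z ∧ (r x z == i) ∧ (r z y == j)) ≡ p

  module _ (I : Fin (suc d) → Bool) where

    E : Fin N → Fin N → Set
    E x y = I (r x y) ≡ true

    fib : Fin N → Fin N → Bool
    fib x u = Y u ∧ I (r x u)

    -- I is an imprimitivity system (index set I ∩ {nonempty relations on Y})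
    record IsImprimitivity : Set where
      field
        zero∈I     : I zero ≡ true
        I≠0        : ∃ λ i → ¬ (i ≡ zero) × I i ≡ true × Occurs i
        I≠all      : ∃ λ i → I i ≡ false × Occurs i
        E-refl     : ∀ x → In x → E x x
        E-sym      : ∀ x y → In x → In y → E x y → E y x
        E-trans    : ∀ x y z → In x → In y → In z → E x y → E y z → E x z
        fibreSize  : ∃ λ (n : ℕ) → ∀ x → In x → count (fib x) ≡ n

    -- i ∈ 𝓘(U,V) where U, V are the fibres of x, y
    InIUV : Fin N → Fin N → Fin (suc d) → Set
    InIUV x y i = ∃ λ u → ∃ λ v → fib x u ≡ true × fib y v ≡ true × r u v ≡ i

    adj : Fin (suc d) → Mat N
    adj i x y = ind (r x y == i)

    restr : Fin N → Fin N → Mat N → Mat N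
    restr x y M u v = ind (fib x u ∧ fib y v) * M u v

    record IsUniform : Set where
      field
        imprimitivity : IsImprimitivity
        -- 𝓘(U,V) = {0..d} ∖ 𝓘 for distinct fibres U, V (within the
        -- relations present on Y)
        I-distinct : ∀ x y → In x → In y → ¬ E x y → ∀ i →
                       (InIUV x y i ⇔ (Occurs i × I i ≡ false))
        coeffs : ∃ λ (a : Fin (suc d) → Fin (suc d) → Fin (suc d) → ℤ) →
                   ∀ x y z → In x → In y → In z →
                   ∀ i j → InIUV x y i → InIUV y z j →
                   ∀ u w →
                   (restr x y (adj i) ⊗ restr y z (adj j)) u w
                     ≡ sumF (λ h → a h i j * restr x z (adj h) u w)

  UnionOfFibres : (Fin (suc d) → Bool) → Set
  UnionOfFibres I = ∀ x y → In x → I (r x y) ≡ true → In y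

  AtLeastTwoFibres : (Fin (suc d) → Bool) → Set
  AtLeastTwoFibres I = ∃ λ x → ∃ λ y → In x × In y × ¬ (I (r x y) ≡ true)

full : {N : ℕ} → Fin N → Bool
full _ = true

record IsAssocScheme {N d : ℕ} (r : Fin N → Fin N → Fin (suc d)) : Set where
  field
    scheme   : IsSchemeOn r full
    nonempty : ∀ i → Occurs r full i

Dismantlable : {N d : ℕ} (r : Fin N → Fin N → Fin (suc d)) (I : Fin (suc d) → Bool) → Set
Dismantlable r I = ∀ Y → UnionOfFibres r Y I → IsSchemeOn r Y

module Submission where

-- Let Y be a union of fibres. The diagonal, symmetry, the imprimitivity axioms
-- and the structure constants a^h_{ij} are inherited from X, because Y meets
-- every fibre it touches in the whole fibre (of size n).  The real content is
-- that the intersection numbers of the relations restricted to Y are constant.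
-- For x ∈ U, y ∈ W and a fibre V, the (x, y)-entry of A_i^{UV} A_j^{VW} shows
-- that #{z ∈ V : (x,z) ∈ R_i, (z,y) ∈ R_j} equals a^h_{ij}, h = r x y, if
-- i ∈ 𝓘(U,V) and j ∈ 𝓘(V,W), and 0 otherwise; and 𝓘(U,V) is 𝓘 or its
-- complement according as U = V or not.  Summing over all v ∈ Y counts every
-- fibre n times, so n · p^h_{ij}(Y) = Σ_{b₁ b₂} K(b₁,b₂) · G_h(b₁,b₂) where
-- K(b₁,b₂) counts the v ∈ Y with [fibre v = U] = b₁ and [fibre v = W] = b₂.
-- These four numbers depend only on n, |Y| and [U = W], hence only on h, and
-- cancelling n ≠ 0 gives the constancy.

open import Defs
open import Data.Nat as ℕ using (ℕ; zero; suc; _+_; _*_)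
import Data.Nat.Properties as ℕP
open import Data.Fin using (Fin; zero; suc; _≟_)
open import Data.Fin.Properties using (suc-injective; any?)
open import Data.Bool using (Bool; true; false; _∧_; not; if_then_else_) renaming (_≟_ to _≟ᵇ_)
open import Data.Bool.Properties using (∧-assoc; ∧-comm; ∧-zeroʳ; ∧-conicalˡ; ∧-conicalʳ; ¬-not; not-¬; not-injective)
open import Data.Integer as ℤ using (ℤ; 0ℤ)
import Data.Integer.Properties as ℤP
open import Data.Product using (∃; _×_; _,_; proj₁; proj₂)
open import Data.Empty using (⊥)
open import Function.Base using (_∘_)
open import Function.Bundles using (_⇔_; Equivalence; mk⇔)
open import Relation.Nullary using (¬_; Dec; yes; no; contradiction)
open import Relation.Nullary.Decidable using (isYes≗does; dec-true; dec-false; _×-dec_)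
open import Relation.Binary.PropositionalEquality
open import Algebra.Properties.Semiring.Sum ℕP.+-*-semiring
  using (sum; sum-cong-≗; ∑-distrib-+; ∑-comm; *-distribˡ-sum; *-distribʳ-sum)

β : Bool → ℕ
β b = if b then 1 else 0

agree : Bool → Bool → Bool
agree b c = if b then c else not c

∧-true : ∀ {a b : Bool} → a ∧ b ≡ true → a ≡ true × b ≡ true
∧-true {a} {b} e = ∧-conicalˡ a b e , ∧-conicalʳ a b e

∧-implied : ∀ a b c → (b ≡ true → c ≡ true) → (a ∧ b) ∧ c ≡ a ∧ b
∧-implied false b     c h = refl
∧-implied true  false c h = refl
∧-implied true  true  c h = h refl

∧-exclusive : ∀ a b c → (b ≡ true → c ≡ true → ⊥) → (a ∧ b) ∧ c ≡ false
∧-exclusive a b c h = ¬-not (λ abc → let ab , c-true = ∧-true {a ∧ b} abc in h (proj₂ (∧-true {a} ab)) c-true)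

∧-swapʳ : ∀ a b c → (a ∧ b) ∧ c ≡ (a ∧ c) ∧ b
∧-swapʳ a b c = trans (∧-assoc a b c) (trans (cong (a ∧_) (∧-comm b c)) (sym (∧-assoc a c b)))

-- The `count` of Defs is the library sum of indicators, so the library's
-- summation lemmas apply to counts.
count≡sum : ∀ {n} (p : Fin n → Bool) → count p ≡ sum (β ∘ p)
count≡sum {zero}  p = refl
count≡sum {suc n} p = cong (β (p zero) +_) (count≡sum (p ∘ suc))

count-cong : ∀ {n} {p q : Fin n → Bool} → (∀ k → p k ≡ q k) → count p ≡ count q
count-cong {p = p} {q} e =
  trans (count≡sum p) (trans (sum-cong-≗ (cong β ∘ e)) (sym (count≡sum q)))

count-split : ∀ {n} (p q : Fin n → Bool) →
              count p ≡ count (λ k → p k ∧ q k) + count (λ k → p k ∧ not (q k))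
count-split p q = begin
  count p                                              ≡⟨ count≡sum p ⟩
  sum (λ k → β (p k))                                  ≡⟨ sum-cong-≗ (λ k → β-split (p k) (q k)) ⟩
  sum (λ k → β (p k ∧ q k) + β (p k ∧ not (q k)))
    ≡⟨ ∑-distrib-+ (λ k → β (p k ∧ q k)) (λ k → β (p k ∧ not (q k))) ⟩
  sum (λ k → β (p k ∧ q k)) + sum (λ k → β (p k ∧ not (q k)))
    ≡⟨ sym (cong₂ _+_ (count≡sum (λ k → p k ∧ q k)) (count≡sum (λ k → p k ∧ not (q k)))) ⟩
  count (λ k → p k ∧ q k) + count (λ k → p k ∧ not (q k)) ∎
  where
  open ≡-Reasoning
  β-split : ∀ b c → β b ≡ β (b ∧ c) + β (b ∧ not c)
  β-split false c     = refl
  β-split true  true  = refl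
  β-split true  false = refl

count-none : ∀ {n} (p : Fin n → Bool) → (∀ k → p k ≡ false) → count p ≡ 0
count-none {zero}  p none = refl
count-none {suc n} p none rewrite none zero = count-none (p ∘ suc) (none ∘ suc)

count-pos : ∀ {n} (p : Fin n → Bool) k → p k ≡ true → ¬ count p ≡ 0
count-pos p zero    pk rewrite pk = λ ()
count-pos p (suc k) pk with p zero
... | true  = λ ()
... | false = count-pos (p ∘ suc) k pk

count-witness : ∀ {n} (p : Fin n → Bool) → ¬ count p ≡ 0 → ∃ λ k → p k ≡ true
count-witness {zero}  p nz = contradiction refl nz
count-witness {suc n} p nz with p zero in p0
... | true  = zero , p0
... | false with count-witness (p ∘ suc) nz
...   | k , pk = suc k , pk

count-fubini : ∀ {m n} (p : Fin m → Bool) (R : Fin m → Fin n → Bool) (q : Fin n → Bool) →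
               sum (λ v → β (p v) * count (λ z → R v z ∧ q z))
                 ≡ sum (λ z → count (λ v → p v ∧ R v z) * β (q z))
count-fubini p R q = begin
  sum (λ v → β (p v) * count (λ z → R v z ∧ q z))
    ≡⟨ sum-cong-≗ (λ v → trans (cong (β (p v) *_) (count≡sum (λ z → R v z ∧ q z)))
                                (*-distribˡ-sum (β (p v)) (λ z → β (R v z ∧ q z)))) ⟩
  sum (λ v → sum (λ z → β (p v) * β (R v z ∧ q z)))
    ≡⟨ sum-cong-≗ (λ v → sum-cong-≗ (λ z → β-shift (p v) (R v z) (q z))) ⟩
  sum (λ v → sum (λ z → β (p v ∧ R v z) * β (q z)))
    ≡⟨ ∑-comm (λ v z → β (p v ∧ R v z) * β (q z)) ⟩
  sum (λ z → sum (λ v → β (p v ∧ R v z) * β (q z)))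
    ≡⟨ sum-cong-≗ (λ z → sym (trans (cong (_* β (q z)) (count≡sum (λ v → p v ∧ R v z)))
                                     (*-distribʳ-sum (β (q z)) (λ v → β (p v ∧ R v z))))) ⟩
  sum (λ z → count (λ v → p v ∧ R v z) * β (q z)) ∎
  where
  open ≡-Reasoning
  β-shift : ∀ a b c → β a * β (b ∧ c) ≡ β (a ∧ b) * β c
  β-shift false b     c = refl
  β-shift true  true  c = refl
  β-shift true  false c = refl

sum-weighted-count : ∀ {n} (p : Fin n → Bool) (c : ℕ) → sum (λ v → β (p v) * c) ≡ count p * c
sum-weighted-count p c = sym (trans (cong (_* c) (count≡sum p)) (*-distribʳ-sum c (β ∘ p)))

Σ𝔹² : (Bool → Bool → ℕ) → ℕ
Σ𝔹² f = (f true true + f true false) + (f false true + f false false)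

Σ𝔹²-cong : ∀ {f g : Bool → Bool → ℕ} → (∀ b₁ b₂ → f b₁ b₂ ≡ g b₁ b₂) → Σ𝔹² f ≡ Σ𝔹² g
Σ𝔹²-cong e = cong₂ _+_ (cong₂ _+_ (e true true) (e true false)) (cong₂ _+_ (e false true) (e false false))

sum-by-colour : ∀ {n} (p c : Fin n → Bool) (F : Fin n → Bool → ℕ) →
                sum (λ v → β (p v) * F v (c v))
                  ≡ sum (λ v → β (p v ∧ c v) * F v true) + sum (λ v → β (p v ∧ not (c v)) * F v false)
sum-by-colour p c F =
  trans (sum-cong-≗ (λ v → split (p v) (c v) (F v)))
        (∑-distrib-+ (λ v → β (p v ∧ c v) * F v true) (λ v → β (p v ∧ not (c v)) * F v false))
  where
  split : ∀ b b′ (f : Bool → ℕ) → β b * f b′ ≡ β (b ∧ b′) * f true + β (b ∧ not b′) * f false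
  split false b′    f = refl
  split true  true  f = sym (ℕP.+-identityʳ _)
  split true  false f = refl

sum-by-colours : ∀ {n} (p c₁ c₂ : Fin n → Bool) (G : Bool → Bool → ℕ) →
                 sum (λ v → β (p v) * G (c₁ v) (c₂ v))
                   ≡ Σ𝔹² (λ b₁ b₂ → count (λ v → (p v ∧ agree b₁ (c₁ v)) ∧ agree b₂ (c₂ v)) * G b₁ b₂)
sum-by-colours p c₁ c₂ G =
  trans (sum-by-colour p c₁ (λ v b → G b (c₂ v)))
        (cong₂ _+_ (inner true) (inner false))
  where
  inner : ∀ b₁ → sum (λ v → β (p v ∧ agree b₁ (c₁ v)) * G b₁ (c₂ v))
                   ≡ count (λ v → (p v ∧ agree b₁ (c₁ v)) ∧ c₂ v) * G b₁ true
                     + count (λ v → (p v ∧ agree b₁ (c₁ v)) ∧ not (c₂ v)) * G b₁ false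
  inner b₁ = trans (sum-by-colour (λ v → p v ∧ agree b₁ (c₁ v)) c₂ (λ _ → G b₁))
                   (cong₂ _+_ (sum-weighted-count (λ v → (p v ∧ agree b₁ (c₁ v)) ∧ c₂ v) (G b₁ true))
                              (sum-weighted-count (λ v → (p v ∧ agree b₁ (c₁ v)) ∧ not (c₂ v)) (G b₁ false)))

==-true : ∀ {m} {a b : Fin m} → a ≡ b → (a == b) ≡ true
==-true {a = a} {b} a≡b = trans (isYes≗does (a ≟ b)) (dec-true (a ≟ b) a≡b)

==-false : ∀ {m} {a b : Fin m} → ¬ a ≡ b → (a == b) ≡ false
==-false {a = a} {b} a≢b = trans (isYes≗does (a ≟ b)) (dec-false (a ≟ b) a≢b)

==-sound : ∀ {m} {a b : Fin m} → (a == b) ≡ true → a ≡ b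
==-sound {a = a} {b} e with a ≟ b
... | yes a≡b = a≡b
==-sound () | no _

==-suc : ∀ {m} (a b : Fin m) → (suc a == suc b) ≡ (a == b)
==-suc a b = by-cases (a ≟ b)
  where
  by-cases : Dec (a ≡ b) → (suc a == suc b) ≡ (a == b)
  by-cases (yes a≡b) = trans (==-true (cong suc a≡b)) (sym (==-true a≡b))
  by-cases (no a≢b)  = trans (==-false (a≢b ∘ suc-injective)) (sym (==-false a≢b))

sumF-cong : ∀ {n} {f g : Fin n → ℤ} → (∀ k → f k ≡ g k) → sumF f ≡ sumF g
sumF-cong {zero}  e = refl
sumF-cong {suc n} e = cong₂ ℤ._+_ (e zero) (sumF-cong (e ∘ suc))

sumF-ind : ∀ {n} (p : Fin n → Bool) → sumF (λ k → ind (p k)) ≡ ℤ.+ count p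
sumF-ind {zero}  p = refl
sumF-ind {suc n} p rewrite sumF-ind (p ∘ suc) with p zero
... | true  = refl
... | false = refl

sumF-zero : ∀ {n} (f : Fin n → ℤ) → (∀ k → f k ≡ 0ℤ) → sumF f ≡ 0ℤ
sumF-zero {zero}  f zeros = refl
sumF-zero {suc n} f zeros =
  trans (cong₂ ℤ._+_ (zeros zero) (sumF-zero (f ∘ suc) (zeros ∘ suc))) (ℤP.+-identityˡ 0ℤ)

sumF-delta : ∀ {n} (f : Fin n → ℤ) (k : Fin n) → sumF (λ h → f h ℤ.* ind (k == h)) ≡ f k
sumF-delta {suc n} f zero = begin
  f zero ℤ.* ind (zero {n} == zero) ℤ.+ sumF (λ h → f (suc h) ℤ.* ind (zero == suc h))
    ≡⟨ cong₂ (λ b s → f zero ℤ.* ind b ℤ.+ s) (==-true {a = zero {n}} refl) (sumF-zero _ off-diagonal) ⟩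
  f zero ℤ.* ℤ.1ℤ ℤ.+ 0ℤ
    ≡⟨ trans (ℤP.+-identityʳ _) (ℤP.*-identityʳ (f zero)) ⟩
  f zero ∎
  where
  open ≡-Reasoning
  off-diagonal : ∀ h → f (suc h) ℤ.* ind (zero == suc h) ≡ 0ℤ
  off-diagonal h = trans (cong (λ b → f (suc h) ℤ.* ind b) (==-false {a = zero} {b = suc h} λ ()))
                         (ℤP.*-zeroʳ (f (suc h)))
sumF-delta {suc n} f (suc k) = begin
  f zero ℤ.* ind (suc k == zero) ℤ.+ sumF (λ h → f (suc h) ℤ.* ind (suc k == suc h))
    ≡⟨ cong₂ ℤ._+_ (trans (cong (λ b → f zero ℤ.* ind b) (==-false {a = suc k} {b = zero} λ ()))
                          (ℤP.*-zeroʳ (f zero)))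
                   (sumF-cong (λ h → cong (λ b → f (suc h) ℤ.* ind b) (==-suc k h))) ⟩
  0ℤ ℤ.+ sumF (λ h → f (suc h) ℤ.* ind (k == h))
    ≡⟨ ℤP.+-identityˡ _ ⟩
  sumF (λ h → f (suc h) ℤ.* ind (k == h))
    ≡⟨ sumF-delta (f ∘ suc) k ⟩
  f (suc k) ∎
  where open ≡-Reasoning

-- The structure of a uniform scheme on X.  The fibre of x is {u : I (r x u)}
-- (on X = full, `fib r full I x u` reduces to I (r x u)); "x ~ v" means I (r x v).

module UniformScheme {N d : ℕ} (r : Fin N → Fin N → Fin (suc d)) (I : Fin (suc d) → Bool)
                     (assoc : IsAssocScheme r) (uniform : IsUniform r full I) where

  open IsAssocScheme assoc using (scheme; nonempty)
  open IsSchemeOn scheme using (diagonal; symmetric; intersect)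
  open IsUniform uniform using (imprimitivity; I-distinct; coeffs)
  open IsImprimitivity imprimitivity using (zero∈I; I≠0; E-refl; E-sym; E-trans; fibreSize)

  n : ℕ
  n = proj₁ fibreSize

  fibre-size : ∀ x → count (λ u → I (r x u)) ≡ n
  fibre-size x = proj₂ fibreSize x refl

  r-sym : ∀ x y → r x y ≡ r y x
  r-sym x y = symmetric x y refl refl

  r-diag : ∀ x → r x x ≡ zero
  r-diag x = Equivalence.from (diagonal x x refl refl) refl

  same-refl : ∀ x → I (r x x) ≡ true
  same-refl x = E-refl x refl

  same-sym : ∀ x y → I (r x y) ≡ true → I (r y x) ≡ true
  same-sym x y = E-sym x y refl refl

  same-trans : ∀ x y z → I (r x y) ≡ true → I (r y z) ≡ true → I (r x z) ≡ true
  same-trans x y z = E-trans x y z refl refl refl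

  n≢0 : Fin N → ¬ n ≡ 0
  n≢0 x = subst (λ k → ¬ k ≡ 0) (fibre-size x) (count-pos (λ u → I (r x u)) x (same-refl x))

  -- Every point has an i-neighbour: R_i is nonempty and the valency p^0_{ii}
  -- is the same at every point.
  neighbour : ∀ x i → ∃ λ w → r x w ≡ i
  neighbour x i with nonempty i | intersect i i zero
  ... | x₀ , y₀ , _ , _ , x₀y₀ | k , valency =
    let w , hit = count-witness (λ z → (r x z == i) ∧ (r z x == i)) at-x≢0
    in  w , ==-sound (proj₁ (∧-true hit))
    where
    at-x₀≢0 : ¬ count (λ z → (r x₀ z == i) ∧ (r z x₀ == i)) ≡ 0
    at-x₀≢0 = count-pos _ y₀ (cong₂ _∧_ (==-true x₀y₀) (==-true (trans (r-sym y₀ x₀) x₀y₀)))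
    at-x≢0 : ¬ count (λ z → (r x z == i) ∧ (r z x == i)) ≡ 0
    at-x≢0 zero-at-x = at-x₀≢0 (trans (valency x₀ x₀ refl refl (r-diag x₀))
                                  (trans (sym (valency x x refl refl (r-diag x))) zero-at-x))

  -- 𝓘(U,V) for the fibres U ∋ x, V ∋ v is 𝓘 if U = V and its complement otherwise.
  InF : Fin N → Fin N → Fin (suc d) → Set
  InF = InIUV r full I

  index-set : ∀ x v i → InF x v i ⇔ agree (I (r x v)) (I i) ≡ true
  index-set x v i = mk⇔ to from
    where
    to : InF x v i → agree (I (r x v)) (I i) ≡ true
    to (u , w , xu , vw , uw) with I (r x v) in xv
    ... | true  = subst (λ t → I t ≡ true) uw (same-trans u x w (same-sym x u xu) (same-trans x v w xv vw))
    ... | false = cong not (proj₂ (Equivalence.to (I-distinct x v refl refl (not-¬ xv) i) (u , w , xu , vw , uw)))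
    from : agree (I (r x v)) (I i) ≡ true → InF x v i
    from allowed with I (r x v) in xv
    ... | true  = let w , xw = neighbour x i
                  in  x , w , same-refl x , same-trans v x w (same-sym x v xv) (subst (λ t → I t ≡ true) (sym xw) allowed) , xw
    ... | false = Equivalence.from (I-distinct x v refl refl (not-¬ xv) i) (nonempty i , not-injective allowed)

  a : Fin (suc d) → Fin (suc d) → Fin (suc d) → ℤ
  a = proj₁ coeffs

  fibreCount : Fin (suc d) → Fin (suc d) → Fin N → Fin N → Fin N → ℕ
  fibreCount i j v x y = count (λ z → I (r v z) ∧ ((r x z == i) ∧ (r z y == j)))

  -- The summand of the (x, y)-entry of A_i^{UV} A_j^{VW} when x ∈ U, y ∈ W.
  indicator-product : ∀ p b c e f → p ≡ true → f ≡ true →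
                      (ind (p ∧ b) ℤ.* ind c) ℤ.* (ind (b ∧ f) ℤ.* ind e) ≡ ind (b ∧ (c ∧ e))
  indicator-product true true  true  true  true refl refl = refl
  indicator-product true true  true  false true refl refl = refl
  indicator-product true true  false true  true refl refl = refl
  indicator-product true true  false false true refl refl = refl
  indicator-product true false true  true  true refl refl = refl
  indicator-product true false true  false true refl refl = refl
  indicator-product true false false true  true refl refl = refl
  indicator-product true false false false true refl refl = refl

  -- Uniformity read off at the entry (x, y): the fibre count is a^{r x y}_{ij}.
  fibreCount-coeff : ∀ i j v x y → InF x v i → InF v y j → ℤ.+ fibreCount i j v x y ≡ a (r x y) i j
  fibreCount-coeff i j v x y xv vy = begin
    ℤ.+ fibreCount i j v x y
      ≡⟨ sym (sumF-ind (λ z → I (r v z) ∧ ((r x z == i) ∧ (r z y == j)))) ⟩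
    sumF (λ z → ind (I (r v z) ∧ ((r x z == i) ∧ (r z y == j))))
      ≡⟨ sumF-cong (λ z → sym (indicator-product (I (r x x)) (I (r v z)) (r x z == i) (r z y == j)
                                                 (I (r y y)) (same-refl x) (same-refl y))) ⟩
    (restr r full I x v (adj r full I i) ⊗ restr r full I v y (adj r full I j)) x y
      ≡⟨ proj₂ coeffs x v y refl refl refl i j xv vy x y ⟩
    sumF (λ h → a h i j ℤ.* (ind (I (r x x) ∧ I (r y y)) ℤ.* ind (r x y == h)))
      ≡⟨ sumF-cong (λ h → cong (λ t → a h i j ℤ.* (ind t ℤ.* ind (r x y == h)))
                               (cong₂ _∧_ (same-refl x) (same-refl y))) ⟩
    sumF (λ h → a h i j ℤ.* (ℤ.1ℤ ℤ.* ind (r x y == h)))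
      ≡⟨ sumF-cong (λ h → cong (a h i j ℤ.*_) (ℤP.*-identityˡ (ind (r x y == h)))) ⟩
    sumF (λ h → a h i j ℤ.* ind (r x y == h))
      ≡⟨ sumF-delta (λ h → a h i j) (r x y) ⟩
    a (r x y) i j ∎
    where open ≡-Reasoning

  -- A point z counted by the fibre count witnesses i ∈ 𝓘(U,V) and j ∈ 𝓘(V,W).
  fibreCount-empty : ∀ i j v x y → ¬ (InF x v i × InF v y j) → fibreCount i j v x y ≡ 0
  fibreCount-empty i j v x y excluded with fibreCount i j v x y ℕ.≟ 0
  ... | yes empty = empty
  ... | no nonzero =
    let z , hit   = count-witness (λ z → I (r v z) ∧ ((r x z == i) ∧ (r z y == j))) nonzero
        vz , xzy  = ∧-true hit
        xz , zy   = ∧-true xzy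
    in  contradiction ((x , z , same-refl x , vz , ==-sound xz) , (z , y , vz , same-refl y , ==-sound zy)) excluded

  -- The fibre count as a function of h = r x y and of whether the fibre of v
  -- is that of x (b₁) and that of y (b₂).
  G : Fin (suc d) → Fin (suc d) → Fin (suc d) → Bool → Bool → ℕ
  G i j h b₁ b₂ = if agree b₁ (I i) ∧ agree b₂ (I j) then ℤ.∣ a h i j ∣ else 0

  fibreCount-pattern : ∀ i j v x y → fibreCount i j v x y ≡ G i j (r x y) (I (r x v)) (I (r v y))
  fibreCount-pattern i j v x y with agree (I (r x v)) (I i) in i-ok | agree (I (r v y)) (I j) in j-ok
  ... | true  | true  = cong ℤ.∣_∣ (fibreCount-coeff i j v x y (Equivalence.from (index-set x v i) i-ok)
                                                             (Equivalence.from (index-set v y j) j-ok))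
  ... | true  | false = fibreCount-empty i j v x y (λ (_ , vy) → not-¬ j-ok (Equivalence.to (index-set v y j) vy))
  ... | false | _     = fibreCount-empty i j v x y (λ (xv , _) → not-¬ i-ok (Equivalence.to (index-set x v i) xv))

  module Dismantled (Y : Fin N → Bool) (Y-union : UnionOfFibres r Y I) where

    fibre-within : ∀ x → Y x ≡ true → ∀ u → Y u ∧ I (r x u) ≡ I (r x u)
    fibre-within x x∈Y u with I (r x u) in xu
    ... | true  rewrite Y-union x u x∈Y xu = refl
    ... | false = ∧-zeroʳ (Y u)

    fibre-size-Y : ∀ x → Y x ≡ true → count (λ u → Y u ∧ I (r x u)) ≡ n
    fibre-size-Y x x∈Y = trans (count-cong (fibre-within x x∈Y)) (fibre-size x)

    fibre-size-Yʳ : ∀ y → Y y ≡ true → count (λ u → Y u ∧ I (r u y)) ≡ n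
    fibre-size-Yʳ y y∈Y = trans (count-cong (λ u → cong (λ t → Y u ∧ I t) (r-sym u y))) (fibre-size-Y y y∈Y)

    fibre-in-Y : ∀ z → count (λ v → Y v ∧ I (r v z)) ≡ n * β (Y z)
    fibre-in-Y z with Y z in z∈Y
    ... | true  = trans (fibre-size-Yʳ z z∈Y) (sym (ℕP.*-identityʳ n))
    ... | false = trans (count-none _ outside) (sym (ℕP.*-zeroʳ n))
      where
      outside : ∀ v → Y v ∧ I (r v z) ≡ false
      outside v with Y v in v∈Y
      ... | false = refl
      ... | true  = ¬-not (λ vz → not-¬ z∈Y (Y-union v z v∈Y vz))

    p : Fin (suc d) → Fin (suc d) → Fin N → Fin N → ℕ
    p i j x y = count (λ z → Y z ∧ ((r x z == i) ∧ (r z y == j)))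

    -- Summing the fibre counts over v ∈ Y counts every z ∈ Y once per point of its fibre.
    double-count : ∀ i j x y → n * p i j x y ≡ sum (λ v → β (Y v) * fibreCount i j v x y)
    double-count i j x y = sym (begin
      sum (λ v → β (Y v) * fibreCount i j v x y)
        ≡⟨ count-fubini Y (λ v z → I (r v z)) P ⟩
      sum (λ z → count (λ v → Y v ∧ I (r v z)) * β (P z))
        ≡⟨ sum-cong-≗ (λ z → trans (cong (_* β (P z)) (fibre-in-Y z)) (ℕP.*-assoc n (β (Y z)) (β (P z)))) ⟩
      sum (λ z → n * (β (Y z) * β (P z)))
        ≡⟨ sum-cong-≗ (λ z → cong (n *_) (β-∧ (Y z) (P z))) ⟩
      sum (λ z → n * β (Y z ∧ P z))
        ≡⟨ sym (*-distribˡ-sum n (λ z → β (Y z ∧ P z))) ⟩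
      n * sum (λ z → β (Y z ∧ P z))
        ≡⟨ cong (n *_) (sym (count≡sum (λ z → Y z ∧ P z))) ⟩
      n * p i j x y ∎)
      where
      open ≡-Reasoning
      P : Fin N → Bool
      P z = (r x z == i) ∧ (r z y == j)
      β-∧ : ∀ b c → β b * β c ≡ β (b ∧ c)
      β-∧ false c     = refl
      β-∧ true  true  = refl
      β-∧ true  false = refl

    profile : Fin N → Fin N → Bool → Bool → ℕ
    profile x y b₁ b₂ = count (λ v → (Y v ∧ agree b₁ (I (r x v))) ∧ agree b₂ (I (r v y)))

    weighted-intersection : ∀ i j x y →
      n * p i j x y ≡ Σ𝔹² (λ b₁ b₂ → profile x y b₁ b₂ * G i j (r x y) b₁ b₂)
    weighted-intersection i j x y =
      trans (double-count i j x y)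
        (trans (sum-cong-≗ (λ v → cong (β (Y v) *_) (fibreCount-pattern i j v x y)))
               (sum-by-colours Y (λ v → I (r x v)) (λ v → I (r v y)) (G i j (r x y))))

    -- The four profile numbers are pinned down by n, |Y| and [x ~ y].
    profile-same : ∀ x y → Y x ≡ true → profile x y true true ≡ n * β (I (r x y))
    profile-same x y x∈Y with I (r x y) in xy
    ... | true  = trans (count-cong (λ v → ∧-implied (Y v) (I (r x v)) (I (r v y))
                                          (λ xv → same-trans v x y (same-sym x v xv) xy)))
                        (trans (fibre-size-Y x x∈Y) (sym (ℕP.*-identityʳ n)))
    ... | false = trans (count-none _ (λ v → ∧-exclusive (Y v) (I (r x v)) (I (r v y))
                                          (λ xv vy → not-¬ xy (same-trans x v y xv vy))))
                        (sym (ℕP.*-zeroʳ n))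

    profile-row : ∀ x y → Y x ≡ true → profile x y true true + profile x y true false ≡ n
    profile-row x y x∈Y =
      trans (sym (count-split (λ v → Y v ∧ I (r x v)) (λ v → I (r v y)))) (fibre-size-Y x x∈Y)

    profile-column : ∀ x y → Y y ≡ true → profile x y true true + profile x y false true ≡ n
    profile-column x y y∈Y =
      trans (cong₂ _+_ (count-cong (λ v → ∧-swapʳ (Y v) (I (r x v)) (I (r v y))))
                       (count-cong (λ v → ∧-swapʳ (Y v) (not (I (r x v))) (I (r v y)))))
            (trans (sym (count-split (λ v → Y v ∧ I (r v y)) (λ v → I (r x v)))) (fibre-size-Yʳ y y∈Y))

    profile-total : ∀ x y → Y x ≡ true → count Y ≡ n + (profile x y false true + profile x y false false)
    profile-total x y x∈Y =
      trans (count-split Y (λ v → I (r x v)))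
            (cong₂ _+_ (fibre-size-Y x x∈Y) (count-split (λ v → Y v ∧ not (I (r x v))) (λ v → I (r v y))))

    profile-determined : ∀ x y x′ y′ → Y x ≡ true → Y y ≡ true → Y x′ ≡ true → Y y′ ≡ true →
                         I (r x y) ≡ I (r x′ y′) → ∀ b₁ b₂ → profile x y b₁ b₂ ≡ profile x′ y′ b₁ b₂
    profile-determined x y x′ y′ x∈Y y∈Y x′∈Y y′∈Y same = λ where
        true  true  → TT
        true  false → TF
        false true  → FT
        false false → FF
      where
      K = profile x y
      K′ = profile x′ y′
      TT : K true true ≡ K′ true true
      TT = trans (profile-same x y x∈Y) (trans (cong (λ b → n * β b) same) (sym (profile-same x′ y′ x′∈Y)))
      TF : K true false ≡ K′ true false
      TF = ℕP.+-cancelˡ-≡ (K true true) _ _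
             (trans (profile-row x y x∈Y) (trans (sym (profile-row x′ y′ x′∈Y)) (cong (_+ K′ true false) (sym TT))))
      FT : K false true ≡ K′ false true
      FT = ℕP.+-cancelˡ-≡ (K true true) _ _
             (trans (profile-column x y y∈Y) (trans (sym (profile-column x′ y′ y′∈Y)) (cong (_+ K′ false true) (sym TT))))
      FF : K false false ≡ K′ false false
      FF = ℕP.+-cancelˡ-≡ (K false true) _ _ (ℕP.+-cancelˡ-≡ n _ _
             (trans (sym (profile-total x y x∈Y))
                    (trans (profile-total x′ y′ x′∈Y) (cong (λ k → n + (k + K′ false false)) (sym FT)))))

    intersection-constant : ∀ i j x y x′ y′ → Y x ≡ true → Y y ≡ true → Y x′ ≡ true → Y y′ ≡ true →
                            r x y ≡ r x′ y′ → p i j x y ≡ p i j x′ y′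
    intersection-constant i j x y x′ y′ x∈Y y∈Y x′∈Y y′∈Y xy≡x′y′ =
      ℕP.*-cancelˡ-≡ _ _ n {{ℕ.≢-nonZero (n≢0 x)}} (begin
        n * p i j x y                                              ≡⟨ weighted-intersection i j x y ⟩
        Σ𝔹² (λ b₁ b₂ → profile x y b₁ b₂ * G i j (r x y) b₁ b₂)
          ≡⟨ Σ𝔹²-cong (λ b₁ b₂ → cong₂ _*_ (same-profile b₁ b₂) (cong (λ h → G i j h b₁ b₂) xy≡x′y′)) ⟩
        Σ𝔹² (λ b₁ b₂ → profile x′ y′ b₁ b₂ * G i j (r x′ y′) b₁ b₂)
          ≡⟨ sym (weighted-intersection i j x′ y′) ⟩
        n * p i j x′ y′ ∎)
      where
      open ≡-Reasoning
      same-profile : ∀ b₁ b₂ → profile x y b₁ b₂ ≡ profile x′ y′ b₁ b₂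
      same-profile = profile-determined x y x′ y′ x∈Y y∈Y x′∈Y y′∈Y (cong I xy≡x′y′)

    scheme-on-Y : IsSchemeOn r Y
    scheme-on-Y = record
      { diagonal  = λ x y _ _ → diagonal x y refl refl
      ; symmetric = λ x y _ _ → r-sym x y
      ; intersect = intersection-number }
      where
      -- If R_h meets Y × Y, take the count at one of its pairs; otherwise any value will do.
      intersection-number : ∀ i j h → ∃ λ k → ∀ x y → Y x ≡ true → Y y ≡ true → r x y ≡ h → p i j x y ≡ k
      intersection-number i j h
        with any? (λ x → any? (λ y → (Y x ≟ᵇ true) ×-dec ((Y y ≟ᵇ true) ×-dec (r x y ≟ h))))
      ... | yes (x₀ , y₀ , x₀∈Y , y₀∈Y , x₀y₀) =
            p i j x₀ y₀ ,
            λ x y x∈Y y∈Y xy → intersection-constant i j x y x₀ y₀ x∈Y y∈Y x₀∈Y y₀∈Y (trans xy (sym x₀y₀))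
      ... | no none = 0 , λ x y x∈Y y∈Y xy → contradiction (x , y , x∈Y , y∈Y , xy) none

    restr-within : ∀ x y → Y x ≡ true → Y y ≡ true → ∀ M u v → restr r Y I x y M u v ≡ restr r full I x y M u v
    restr-within x y x∈Y y∈Y M u v =
      cong (λ b → ind b ℤ.* M u v) (cong₂ _∧_ (fibre-within x x∈Y u) (fibre-within y y∈Y v))

    InIUV-within : ∀ x y i → Y x ≡ true → Y y ≡ true → InIUV r Y I x y i → InF x y i
    InIUV-within x y i x∈Y y∈Y (u , v , xu , yv , uv) =
      u , v , trans (sym (fibre-within x x∈Y u)) xu , trans (sym (fibre-within y y∈Y v)) yv , uv

    index-set-Y : ∀ x y → Y x ≡ true → Y y ≡ true → ¬ I (r x y) ≡ true → ∀ i →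
                  InIUV r Y I x y i ⇔ (Occurs r Y i × I i ≡ false)
    index-set-Y x y x∈Y y∈Y x≁y i = mk⇔ to from
      where
      to : InIUV r Y I x y i → Occurs r Y i × I i ≡ false
      to uv@(u , v , xu , yv , u-v) =
        (u , v , proj₁ (∧-true xu) , proj₁ (∧-true yv) , u-v) ,
        proj₂ (Equivalence.to (I-distinct x y refl refl x≁y i) (InIUV-within x y i x∈Y y∈Y uv))
      from : Occurs r Y i × I i ≡ false → InIUV r Y I x y i
      from (_ , i∉I) =
        let u , v , xu , yv , u-v = Equivalence.from (I-distinct x y refl refl x≁y i) (nonempty i , i∉I)
        in  u , v , trans (fibre-within x x∈Y u) xu , trans (fibre-within y y∈Y v) yv , u-v

    coeffs-Y : ∀ x y z → Y x ≡ true → Y y ≡ true → Y z ≡ true →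
               ∀ i j → InIUV r Y I x y i → InIUV r Y I y z j → ∀ u w →
               (restr r Y I x y (adj r Y I i) ⊗ restr r Y I y z (adj r Y I j)) u w
                 ≡ sumF (λ h → a h i j ℤ.* restr r Y I x z (adj r Y I h) u w)
    coeffs-Y x y z x∈Y y∈Y z∈Y i j xy yz u w = begin
      (restr r Y I x y (adj r Y I i) ⊗ restr r Y I y z (adj r Y I j)) u w
        ≡⟨ sumF-cong (λ v → cong₂ ℤ._*_ (restr-within x y x∈Y y∈Y (adj r Y I i) u v)
                                         (restr-within y z y∈Y z∈Y (adj r Y I j) v w)) ⟩
      (restr r full I x y (adj r full I i) ⊗ restr r full I y z (adj r full I j)) u w
        ≡⟨ proj₂ coeffs x y z refl refl refl i j (InIUV-within x y i x∈Y y∈Y xy) (InIUV-within y z j y∈Y z∈Y yz) u w ⟩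
      sumF (λ h → a h i j ℤ.* restr r full I x z (adj r full I h) u w)
        ≡⟨ sumF-cong (λ h → cong (a h i j ℤ.*_) (sym (restr-within x z x∈Y z∈Y (adj r Y I h) u w))) ⟩
      sumF (λ h → a h i j ℤ.* restr r Y I x z (adj r Y I h) u w) ∎
      where open ≡-Reasoning

    uniform-on-Y : AtLeastTwoFibres r Y I → IsUniform r Y I
    uniform-on-Y (x₁ , y₁ , x₁∈Y , y₁∈Y , x₁≁y₁) = record
      { imprimitivity = record
          { zero∈I    = zero∈I
          ; I≠0       = nontrivial-in-Y
          ; I≠all     = r x₁ y₁ , ¬-not x₁≁y₁ , x₁ , y₁ , x₁∈Y , y₁∈Y , refl
          ; E-refl    = λ x _ → same-refl x
          ; E-sym     = λ x y _ _ → same-sym x y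
          ; E-trans   = λ x y z _ _ _ → same-trans x y z
          ; fibreSize = n , fibre-size-Y }
      ; I-distinct = index-set-Y
      ; coeffs     = a , coeffs-Y }
      where
      -- A nontrivial relation inside the fibres occurs within the fibre of x₁ ⊆ Y.
      nontrivial-in-Y : ∃ λ i → ¬ i ≡ zero × I i ≡ true × Occurs r Y i
      nontrivial-in-Y =
        let i , i≢0 , i∈I , _ = I≠0
            w , x₁w = neighbour x₁ i
            x₁~w = subst (λ t → I t ≡ true) (sym x₁w) i∈I
        in  i , i≢0 , i∈I , x₁ , w , x₁∈Y , Y-union x₁ w x₁∈Y x₁~w , x₁w

theorem3p3 : ∀ {N d : ℕ} (r : Fin N → Fin N → Fin (suc d)) (I : Fin (suc d) → Bool) →
    IsAssocScheme r → IsUniform r full I →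
    Dismantlable r I ×
    (∀ Y → UnionOfFibres r Y I → AtLeastTwoFibres r Y I → IsUniform r Y I)
theorem3p3 r I assoc uniform =
    (λ Y Y-union → scheme-on-Y Y Y-union)
  , (λ Y Y-union → uniform-on-Y Y Y-union)
  where open UniformScheme r I assoc uniform using (module Dismantled)
        open Dismantled
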